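{- Let $\lambda\ge 2$ and let $L(0,n-1)$ be a path with thresholds $t(0)=t(n-1)=1$ and $t(i)\in\{1,2\}$ for $1\le i\le n-2$. Suppose $L(j,k)$ is a 2-path with $m=k-j-1\ne 2$. Then $$OPT(0,n-1)=OPT(0,j,\overset{1}{\rightarrow})+k-j-2+OPT(\overset{1}{\leftarrow},k,n-1).$$
   Context: $L(0,n-1)$ is the path with nodes $0,\dots,n-1$ and edges $\{i,i+1\}$; $L(j,k)$ ($0\le j\le k\le n-1$) is the subpath induced by $j,\dots,k$, with the original thresholds. $L(j,k)$ with $j+1\le k-1$ is a 2-path if $t(j+1)=\dots=t(k-1)=2$ and $t(j)=t(k)=1$. Incentives $p$ satisfy $0\le p(i)\le t(i)$, the influence process is $\mathsf{Influenced}[p,0]=\{v:p(v)=t(v)\}$, $\mathsf{Influenced}[p,\ell]=\mathsf{Influenced}[p,\ell-1]\cup\{v:|N(v)\cap\mathsf{Influenced}[p,\ell-1]|\ge t(v)-p(v)\}$, and the TBI problem asks for incentives of minimum total cost influencing all nodes within $\lambda$ rounds. $OPT(0,n-1)$ is the optimal TBI cost on $L(0,n-1)$. $OPT(j,k,\overset{\ell}{\rightarrow})$ is the optimal TBI cost on $L(j,k)$ (process run on $L(j,k)$ alone) under the additional condition that node $k$ is influenced by round $\lambda-\ell$ without getting influence from node $k+1$; $OPT(\overset{\ell}{\leftarrow},j,k)$ is the optimal TBI cost on $L(j,k)$ under the additional condition that node $j$ is influenced by round $\lambda-\ell$ without getting influence from node $j-1$. -}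

module Defs where

open import Data.Nat using (ℕ; zero; suc; _+_; _∸_; _≤_; _<_; _≤ᵇ_; _<ᵇ_; _≡ᵇ_)
open import Data.Bool using (Bool; true; false; _∧_; _∨_; if_then_else_)
open import Data.List using (map; upTo)
open import Data.Nat.ListAction using (sum)
open import Data.Product using (Σ; _×_)
open import Data.Sum using (_⊎_)
open import Relation.Binary.PropositionalEquality using (_≡_)

-- Nodes are natural numbers; thresholds t and incentives p are functions ℕ → ℕ
-- (only their values on the relevant node range matter).

inRange : ℕ → ℕ → ℕ → Bool
inRange j k v = (j ≤ᵇ v) ∧ (v ≤ᵇ k)

nbrCount : ℕ → ℕ → (ℕ → Bool) → ℕ → ℕ
nbrCount j k S v =
  (if (j <ᵇ v) ∧ S (v ∸ 1) then 1 else 0) +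
  (if (v <ᵇ k) ∧ S (suc v) then 1 else 0)

Influenced : (j k : ℕ) → (t p : ℕ → ℕ) → ℕ → ℕ → Bool
Influenced j k t p zero v = inRange j k v ∧ (p v ≡ᵇ t v)
Influenced j k t p (suc ℓ) v =
  Influenced j k t p ℓ v ∨
  (inRange j k v ∧ ((t v ∸ p v) ≤ᵇ nbrCount j k (Influenced j k t p ℓ) v))

cost : (j k : ℕ) → (ℕ → ℕ) → ℕ
cost j k p = sum (map (λ i → p (j + i)) (upTo (suc (k ∸ j))))

Admissible : (j k : ℕ) → (t p : ℕ → ℕ) → Set
Admissible j k t p = ∀ i → j ≤ i → i ≤ k → p i ≤ t i

TBI : (λ′ j k : ℕ) → (t p : ℕ → ℕ) → Set
TBI λ′ j k t p =
  Admissible j k t p × (∀ v → j ≤ v → v ≤ k → Influenced j k t p λ′ v ≡ true)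

-- additionally node k is influenced by round λ - ℓ (within L(j,k), i.e. without node k+1)
TBI→ : (λ′ ℓ j k : ℕ) → (t p : ℕ → ℕ) → Set
TBI→ λ′ ℓ j k t p = TBI λ′ j k t p × (Influenced j k t p (λ′ ∸ ℓ) k ≡ true)

-- additionally node j is influenced by round λ - ℓ (within L(j,k), i.e. without node j-1)
TBI← : (λ′ ℓ j k : ℕ) → (t p : ℕ → ℕ) → Set
TBI← λ′ ℓ j k t p = TBI λ′ j k t p × (Influenced j k t p (λ′ ∸ ℓ) j ≡ true)

IsOpt : (j k : ℕ) → ((ℕ → ℕ) → Set) → ℕ → Set
IsOpt j k P c =
  Σ (ℕ → ℕ) (λ p → P p × cost j k p ≡ c) × (∀ p → P p → c ≤ cost j k p)

TwoPath : (t : ℕ → ℕ) → (j k : ℕ) → Set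
TwoPath t j k =
  (j + 1 ≤ k ∸ 1) × (t j ≡ 1) × (t k ≡ 1) × (∀ i → j < i → i < k → t i ≡ 2)

PathThresholds : ℕ → (ℕ → ℕ) → Set
PathThresholds n t =
  (t 0 ≡ 1) × (t (n ∸ 1) ≡ 1) × (∀ i → 1 ≤ i → i ≤ n ∸ 2 → (t i ≡ 1) ⊎ (t i ≡ 2))

-- Let m = k - j - 1 be the number of interior nodes of the 2-path.
--
-- Lower bound. Let τ v be the first round in which v is influenced. An interior node with
-- incentive p v needs 2 - p v neighbours influenced strictly before it, and of the two ends
-- of an edge at most one precedes the other; summing over the interior nodes, their
-- incentives total at least m + 1 - [τ j < τ (j+1)] - [τ k < τ (k-1)]. If τ j < τ (j+1),
-- node j never relies on j+1, so the solution restricted to L(0,j) influences j by round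
-- λ-1 on its own; otherwise raising p j to t j = 1 achieves this. Symmetrically at k, so
-- every solution costs at least OPT(0,j,→) + (m-1) + OPT(←,k,n-1).
--
-- Upper bound. Glue optimal solutions of the two sides with the interior incentives
-- 0,2,0,2,…,2,0 (m odd) or 0,2,…,0,2,1,0 (m even), which cost m - 1: the 2's are seeds,
-- the 1 is influenced in round 1 by the seed before it, and then every 0 has both
-- neighbours influenced by round λ-1. This needs λ ≥ 2, and fails for m = 2, where the
-- 1 can only rely on j.

module Submission where

open import Defs
open import Data.Nat
open import Data.Nat.Properties
open import Data.Nat.Tactic.RingSolver using (solve-∀)
open import Data.Bool using (Bool; true; false; _∧_; _∨_; if_then_else_; T)
open import Data.Bool.Properties using () renaming (_≟_ to _≟ᵇ_)
open import Data.List using (map; applyUpTo)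
open import Data.Nat.ListAction using (sum)
open import Data.Product using (Σ; _×_; _,_; proj₁; proj₂)
open import Data.Sum using (_⊎_; inj₁; inj₂)
open import Data.Empty using (⊥; ⊥-elim)
open import Data.Unit using (tt)
open import Function using (_∘_)
open import Relation.Binary.PropositionalEquality
open import Relation.Nullary using (¬_; Dec; yes; no; contradiction)
open import Relation.Nullary.Decidable using (map′; _×-dec_; _→-dec_)

T⇒≡true : ∀ {b} → T b → b ≡ true
T⇒≡true {true} _ = refl

≡true⇒T : ∀ {b} → b ≡ true → T b
≡true⇒T refl = tt

≤ᵇ-complete : ∀ {m n} → m ≤ n → (m ≤ᵇ n) ≡ true
≤ᵇ-complete = T⇒≡true ∘ ≤⇒≤ᵇ

≤ᵇ-sound : ∀ {m n} → (m ≤ᵇ n) ≡ true → m ≤ n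
≤ᵇ-sound {m} {n} = ≤ᵇ⇒≤ m n ∘ ≡true⇒T

<ᵇ-complete : ∀ {m n} → m < n → (m <ᵇ n) ≡ true
<ᵇ-complete = T⇒≡true ∘ <⇒<ᵇ

<ᵇ-sound : ∀ {m n} → (m <ᵇ n) ≡ true → m < n
<ᵇ-sound {m} {n} = <ᵇ⇒< m n ∘ ≡true⇒T

≡ᵇ-complete : ∀ {m n} → m ≡ n → (m ≡ᵇ n) ≡ true
≡ᵇ-complete {m} {n} = T⇒≡true ∘ ≡⇒≡ᵇ m n

≡ᵇ-sound : ∀ {m n} → (m ≡ᵇ n) ≡ true → m ≡ n
≡ᵇ-sound {m} {n} = ≡ᵇ⇒≡ m n ∘ ≡true⇒T

∧-intro : ∀ {x y} → x ≡ true → y ≡ true → (x ∧ y) ≡ true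
∧-intro refl refl = refl

∧-elimˡ : ∀ x {y} → (x ∧ y) ≡ true → x ≡ true
∧-elimˡ true _ = refl

∧-elimʳ : ∀ x {y} → (x ∧ y) ≡ true → y ≡ true
∧-elimʳ true e = e

∨-introˡ : ∀ {x} y → x ≡ true → (x ∨ y) ≡ true
∨-introˡ _ refl = refl

∨-introʳ : ∀ x {y} → y ≡ true → (x ∨ y) ≡ true
∨-introʳ true _ = refl
∨-introʳ false e = e

∨-elim : ∀ x {y} → (x ∨ y) ≡ true → x ≡ true ⊎ y ≡ true
∨-elim true _ = inj₁ refl
∨-elim false e = inj₂ e

≢true⇒≡false : ∀ {x} → x ≢ true → x ≡ false
≢true⇒≡false {false} _ = refl
≢true⇒≡false {true} x≢true = contradiction refl x≢true

indicator : Bool → ℕ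
indicator b = if b then 1 else 0

indicator-mono : ∀ {x y} → (x ≡ true → y ≡ true) → indicator x ≤ indicator y
indicator-mono {false} _ = z≤n
indicator-mono {true} x⇒y rewrite x⇒y refl = ≤-refl

1≤indicator : ∀ {x} → x ≡ true → 1 ≤ indicator x
1≤indicator refl = ≤-refl

inRange-intro : ∀ {a b v} → a ≤ v → v ≤ b → inRange a b v ≡ true
inRange-intro a≤v v≤b = ∧-intro (≤ᵇ-complete a≤v) (≤ᵇ-complete v≤b)

inRange-elim : ∀ a b v → inRange a b v ≡ true → a ≤ v × v ≤ b
inRange-elim a b v e = ≤ᵇ-sound (∧-elimˡ (a ≤ᵇ v) e) , ≤ᵇ-sound (∧-elimʳ (a ≤ᵇ v) e)

all-inRange? : ∀ a b {Q : ℕ → Set} → (∀ i → Dec (Q i)) → Dec (∀ i → a ≤ i → i ≤ b → Q i)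
all-inRange? a b Q? =
  map′ (λ f i a≤i i≤b → f {i} (s≤s i≤b) a≤i) (λ f {i} i<1+b a≤i → f i a≤i (s≤s⁻¹ i<1+b))
       (allUpTo? (λ i → a ≤? i →-dec Q? i) (suc b))

-- Finite sums and costs

∑ : ℕ → (ℕ → ℕ) → ℕ
∑ zero f = 0
∑ (suc d) f = f 0 + ∑ d (f ∘ suc)

syntax ∑ d (λ i → e) = ∑[ i < d ] e

∑-cong : ∀ d {f g} → (∀ i → i < d → f i ≡ g i) → ∑ d f ≡ ∑ d g
∑-cong zero _ = refl
∑-cong (suc d) f≗g = cong₂ _+_ (f≗g 0 z<s) (∑-cong d (λ i i<d → f≗g (suc i) (s<s i<d)))

∑-mono : ∀ d {f g} → (∀ i → i < d → f i ≤ g i) → ∑ d f ≤ ∑ d g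
∑-mono zero _ = z≤n
∑-mono (suc d) f≤g = +-mono-≤ (f≤g 0 z<s) (∑-mono d (λ i i<d → f≤g (suc i) (s<s i<d)))

∑-++ : ∀ d e f → ∑ (d + e) f ≡ ∑ d f + ∑[ i < e ] f (d + i)
∑-++ zero e f = refl
∑-++ (suc d) e f = trans (cong (f 0 +_) (∑-++ d e (f ∘ suc))) (sym (+-assoc (f 0) _ _))

∑-distrib-+ : ∀ d f g → ∑[ i < d ] (f i + g i) ≡ ∑ d f + ∑ d g
∑-distrib-+ zero f g = refl
∑-distrib-+ (suc d) f g =
  trans (cong (f 0 + g 0 +_) (∑-distrib-+ d (f ∘ suc) (g ∘ suc))) (shuffle (f 0) (g 0) _ _)
  where
  shuffle : ∀ a b c e → a + b + (c + e) ≡ a + c + (b + e)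
  shuffle = solve-∀

∑-const : ∀ d c → ∑[ _ < d ] c ≡ d * c
∑-const zero c = refl
∑-const (suc d) c = cong (c +_) (∑-const d c)

∑-update-≤ : ∀ d {f g} i c → i < d → (∀ l → l < d → l ≢ i → f l ≤ g l) → f i ≤ c →
  ∑ d f ≤ ∑ d g + c
∑-update-≤ (suc d) {f} {g} zero c _ f≤g f0≤c = begin
  f 0 + ∑ d (f ∘ suc)  ≤⟨ +-mono-≤ f0≤c (∑-mono d (λ l l<d → f≤g (suc l) (s<s l<d) λ ())) ⟩
  c + ∑ d (g ∘ suc)    ≡⟨ +-comm c _ ⟩
  ∑ d (g ∘ suc) + c    ≤⟨ +-monoˡ-≤ c (m≤n+m _ (g 0)) ⟩
  ∑ (suc d) g + c      ∎
  where open ≤-Reasoning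
∑-update-≤ (suc d) {f} {g} (suc i) c (s<s i<d) f≤g fi≤c = begin
  f 0 + ∑ d (f ∘ suc)        ≤⟨ +-mono-≤ (f≤g 0 z<s λ ()) rest ⟩
  g 0 + (∑ d (g ∘ suc) + c)  ≡⟨ +-assoc (g 0) _ c ⟨
  ∑ (suc d) g + c            ∎
  where
  open ≤-Reasoning
  rest : ∑ d (f ∘ suc) ≤ ∑ d (g ∘ suc) + c
  rest = ∑-update-≤ d i c i<d (λ l l<d l≢i → f≤g (suc l) (s<s l<d) (l≢i ∘ suc-injective)) fi≤c

sum-map-applyUpTo : ∀ n (f g : ℕ → ℕ) → sum (map f (applyUpTo g n)) ≡ ∑[ i < n ] f (g i)
sum-map-applyUpTo zero f g = refl
sum-map-applyUpTo (suc n) f g = cong (f (g 0) +_) (sum-map-applyUpTo n f (g ∘ suc))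

cost-∑ : ∀ a b p → cost a b p ≡ ∑[ i < suc (b ∸ a) ] p (a + i)
cost-∑ a b p = sum-map-applyUpTo (suc (b ∸ a)) (λ i → p (a + i)) (λ i → i)

offset≤ : ∀ {a b i} → a ≤ b → i < suc (b ∸ a) → a + i ≤ b
offset≤ {a} {i = i} a≤b i<d = subst (a + i ≤_) (m+[n∸m]≡n a≤b) (+-monoʳ-≤ a (s≤s⁻¹ i<d))

cost-cong : ∀ {a b} {p q : ℕ → ℕ} → a ≤ b → (∀ v → a ≤ v → v ≤ b → p v ≡ q v) →
  cost a b p ≡ cost a b q
cost-cong {a} {b} {p} {q} a≤b p≗q = begin
  cost a b p                       ≡⟨ cost-∑ a b p ⟩
  ∑[ i < suc (b ∸ a) ] p (a + i)   ≡⟨ ∑-cong (suc (b ∸ a)) (λ i i<d → p≗q (a + i) (m≤m+n a i) (offset≤ a≤b i<d)) ⟩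
  ∑[ i < suc (b ∸ a) ] q (a + i)   ≡⟨ cost-∑ a b q ⟨
  cost a b q                       ∎
  where open ≡-Reasoning

cost-from : ∀ c y p → cost c (c + y) p ≡ ∑[ i < suc y ] p (c + i)
cost-from c y p = trans (cost-∑ c (c + y) p) (cong (λ d → ∑[ i < suc d ] p (c + i)) (m+n∸m≡n c y))

cost-split : ∀ {a c b} p → a ≤ c → c < b → cost a b p ≡ cost a c p + cost (suc c) b p
cost-split {a} p a≤c c<b with m≤n⇒∃[o]m+o≡n a≤c | m≤n⇒∃[o]m+o≡n c<b
... | x , refl | y , refl = begin
  cost a (suc (a + x) + y) p                                     ≡⟨ cong (λ b → cost a b p) (shift a x y) ⟩
  cost a (a + (x + suc y)) p                                     ≡⟨ cost-from a (x + suc y) p ⟩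
  ∑[ i < suc x + suc y ] p (a + i)                               ≡⟨ ∑-++ (suc x) (suc y) (λ i → p (a + i)) ⟩
  ∑[ i < suc x ] p (a + i) + ∑[ i < suc y ] p (a + (suc x + i))  ≡⟨ cong₂ _+_ (cost-from a x p) right ⟨
  cost a (a + x) p + cost (suc (a + x)) (suc (a + x) + y) p      ∎
  where
  open ≡-Reasoning
  shift : ∀ a x y → suc (a + x) + y ≡ a + (x + suc y)
  shift = solve-∀
  reassoc : ∀ a x i → suc (a + x) + i ≡ a + (suc x + i)
  reassoc = solve-∀
  right : cost (suc (a + x)) (suc (a + x) + y) p ≡ ∑[ i < suc y ] p (a + (suc x + i))
  right = trans (cost-from (suc (a + x)) y p) (∑-cong (suc y) λ i _ → cong p (reassoc a x i))

cost-split₃ : ∀ {a j y b} p → a ≤ j → j < y → y < b →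
  cost a b p ≡ cost a j p + cost (suc j) y p + cost (suc y) b p
cost-split₃ {a} {j} {y} {b} p a≤j j<y y<b = begin
  cost a b p                                            ≡⟨ cost-split p a≤j (<-trans j<y y<b) ⟩
  cost a j p + cost (suc j) b p                         ≡⟨ cong (cost a j p +_) (cost-split p j<y y<b) ⟩
  cost a j p + (cost (suc j) y p + cost (suc y) b p)    ≡⟨ +-assoc (cost a j p) _ _ ⟨
  cost a j p + cost (suc j) y p + cost (suc y) b p      ∎
  where open ≡-Reasoning

_[_]≔_ : (ℕ → ℕ) → ℕ → ℕ → ℕ → ℕ
(p [ w ]≔ c) v = if v ≡ᵇ w then c else p v

[]≔-≡ : ∀ p w c → (p [ w ]≔ c) w ≡ c
[]≔-≡ p w c rewrite ≡ᵇ-complete {w} refl = refl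

[]≔-≢ : ∀ p {w} c {v} → v ≢ w → (p [ w ]≔ c) v ≡ p v
[]≔-≢ p {w} c {v} v≢w with v ≡ᵇ w in eq
... | true = contradiction (≡ᵇ-sound eq) v≢w
... | false = refl

cost-[]≔-≤ : ∀ {a b w} p c → a ≤ w → w ≤ b → cost a b (p [ w ]≔ c) ≤ cost a b p + c
cost-[]≔-≤ {a} {b} {w} p c a≤w w≤b = begin
  cost a b (p [ w ]≔ c)                         ≡⟨ cost-∑ a b (p [ w ]≔ c) ⟩
  ∑[ i < suc (b ∸ a) ] (p [ w ]≔ c) (a + i)     ≤⟨ ∑-update-≤ (suc (b ∸ a)) (w ∸ a) c (s≤s (∸-monoˡ-≤ a w≤b)) unchanged changed ⟩
  ∑[ i < suc (b ∸ a) ] p (a + i) + c            ≡⟨ cong (_+ c) (cost-∑ a b p) ⟨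
  cost a b p + c                                ∎
  where
  open ≤-Reasoning
  unchanged : ∀ i → i < suc (b ∸ a) → i ≢ w ∸ a → (p [ w ]≔ c) (a + i) ≤ p (a + i)
  unchanged i _ i≢w∸a = ≤-reflexive ([]≔-≢ p c λ a+i≡w → i≢w∸a (trans (sym (m+n∸m≡n a i)) (cong (_∸ a) a+i≡w)))
  changed : (p [ w ]≔ c) (a + (w ∸ a)) ≤ c
  changed = ≤-reflexive (trans (cong (p [ w ]≔ c) (m+[n∸m]≡n a≤w)) ([]≔-≡ p w c))

-- The influence process

module Influence (a b : ℕ) (t p : ℕ → ℕ) where

  I : ℕ → ℕ → Bool
  I = Influenced a b t p

  influenced⇒inRange : ∀ ℓ v → I ℓ v ≡ true → a ≤ v × v ≤ b
  influenced⇒inRange zero v e = inRange-elim a b v (∧-elimˡ _ e)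
  influenced⇒inRange (suc ℓ) v e with ∨-elim (I ℓ v) e
  ... | inj₁ e′ = influenced⇒inRange ℓ v e′
  ... | inj₂ e′ = inRange-elim a b v (∧-elimˡ _ e′)

  influenced-suc : ∀ ℓ v → I ℓ v ≡ true → I (suc ℓ) v ≡ true
  influenced-suc ℓ v = ∨-introˡ _

  influenced-later : ∀ {ℓ ℓ′} v → ℓ ≤ ℓ′ → I ℓ v ≡ true → I ℓ′ v ≡ true
  influenced-later {ℓ′ = zero} v z≤n e = e
  influenced-later {ℓ′ = suc ℓ′} v ℓ≤ℓ′ e with m≤n⇒m<n∨m≡n ℓ≤ℓ′
  ... | inj₁ (s≤s ℓ≤) = influenced-suc ℓ′ v (influenced-later v ℓ≤ e)
  ... | inj₂ refl = e

  seeded : ∀ {v} → a ≤ v → v ≤ b → p v ≡ t v → I 0 v ≡ true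
  seeded a≤v v≤b pv≡tv = ∧-intro (inRange-intro a≤v v≤b) (≡ᵇ-complete pv≡tv)

  seeded⁻¹ : ∀ v → I 0 v ≡ true → p v ≡ t v
  seeded⁻¹ v e = ≡ᵇ-sound (∧-elimʳ (inRange a b v) e)

  step : ∀ ℓ {v} → a ≤ v → v ≤ b → t v ∸ p v ≤ nbrCount a b (I ℓ) v → I (suc ℓ) v ≡ true
  step ℓ {v} a≤v v≤b enough = ∨-introʳ (I ℓ v) (∧-intro (inRange-intro a≤v v≤b) (≤ᵇ-complete enough))

  step⁻¹ : ∀ ℓ v → I (suc ℓ) v ≡ true → I ℓ v ≡ true ⊎ t v ∸ p v ≤ nbrCount a b (I ℓ) v
  step⁻¹ ℓ v e with ∨-elim (I ℓ v) e
  ... | inj₁ e′ = inj₁ e′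
  ... | inj₂ e′ = inj₂ (≤ᵇ-sound (∧-elimʳ (inRange a b v) e′))

nbrCount-mono : ∀ a b a′ b′ (S S′ : ℕ → Bool) v →
  ((a <ᵇ v) ≡ true → S (v ∸ 1) ≡ true → (a′ <ᵇ v) ≡ true × S′ (v ∸ 1) ≡ true) →
  ((v <ᵇ b) ≡ true → S (suc v) ≡ true → (v <ᵇ b′) ≡ true × S′ (suc v) ≡ true) →
  nbrCount a b S v ≤ nbrCount a′ b′ S′ v
nbrCount-mono a b a′ b′ S S′ v left right = +-mono-≤ (indicator-mono (lift left)) (indicator-mono (lift right))
  where
  lift : ∀ {x y x′ y′} → (x ≡ true → y ≡ true → x′ ≡ true × y′ ≡ true) → (x ∧ y) ≡ true → (x′ ∧ y′) ≡ true
  lift {x} f e with f (∧-elimˡ x e) (∧-elimʳ x e)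
  ... | e₁ , e₂ = ∧-intro e₁ e₂

influenced-widen : ∀ {a b a′ b′} t {p p′} → a′ ≤ a → b ≤ b′ →
  (∀ v → a ≤ v → v ≤ b → p v ≤ p′ v) → Admissible a b t p′ →
  ∀ ℓ v → Influenced a b t p ℓ v ≡ true → Influenced a′ b′ t p′ ℓ v ≡ true
influenced-widen {a} {b} {a′} {b′} t {p} {p′} a′≤a b≤b′ p≤p′ admissible = go
  where
  module X = Influence a b t p
  module Y = Influence a′ b′ t p′
  go : ∀ ℓ v → X.I ℓ v ≡ true → Y.I ℓ v ≡ true
  go zero v e =
    let (a≤v , v≤b) = X.influenced⇒inRange 0 v e in
    Y.seeded (≤-trans a′≤a a≤v) (≤-trans v≤b b≤b′)
      (≤-antisym (admissible v a≤v v≤b) (subst (_≤ p′ v) (X.seeded⁻¹ v e) (p≤p′ v a≤v v≤b)))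
  go (suc ℓ) v e with X.step⁻¹ ℓ v e
  ... | inj₁ e′ = Y.influenced-suc ℓ v (go ℓ v e′)
  ... | inj₂ enough =
    let (a≤v , v≤b) = X.influenced⇒inRange (suc ℓ) v e in
    Y.step ℓ (≤-trans a′≤a a≤v) (≤-trans v≤b b≤b′) (begin
      t v ∸ p′ v               ≤⟨ ∸-monoʳ-≤ (t v) (p≤p′ v a≤v v≤b) ⟩
      t v ∸ p v                ≤⟨ enough ⟩
      nbrCount a b (X.I ℓ) v   ≤⟨ nbrCount-mono a b a′ b′ (X.I ℓ) (Y.I ℓ) v left right ⟩
      nbrCount a′ b′ (Y.I ℓ) v ∎)
    where
    open ≤-Reasoning
    left : (a <ᵇ v) ≡ true → X.I ℓ (v ∸ 1) ≡ true → (a′ <ᵇ v) ≡ true × Y.I ℓ (v ∸ 1) ≡ true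
    left a<v e′ = <ᵇ-complete (≤-<-trans a′≤a (<ᵇ-sound {a} {v} a<v)) , go ℓ (v ∸ 1) e′
    right : (v <ᵇ b) ≡ true → X.I ℓ (suc v) ≡ true → (v <ᵇ b′) ≡ true × Y.I ℓ (suc v) ≡ true
    right v<b e′ = <ᵇ-complete (<-≤-trans (<ᵇ-sound {v} {b} v<b) b≤b′) , go ℓ (suc v) e′

influenced-restrictˡ : ∀ {a b j} t p →
  (∀ ℓ → Influenced a b t p ℓ (suc j) ≡ true → Influenced a b t p ℓ j ≡ true) →
  ∀ ℓ v → v ≤ j → Influenced a b t p ℓ v ≡ true → Influenced a j t p ℓ v ≡ true
influenced-restrictˡ {a} {b} {j} t p no-earlier-right = go
  where
  module X = Influence a b t p
  module Y = Influence a j t p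
  go : ∀ ℓ v → v ≤ j → X.I ℓ v ≡ true → Y.I ℓ v ≡ true
  go zero v v≤j e = Y.seeded (proj₁ (X.influenced⇒inRange 0 v e)) v≤j (X.seeded⁻¹ v e)
  go (suc ℓ) v v≤j e with X.I ℓ v in eℓ | X.step⁻¹ ℓ v e
  ... | true | _ = Y.influenced-suc ℓ v (go ℓ v v≤j eℓ)
  ... | false | inj₂ enough =
    Y.step ℓ (proj₁ (X.influenced⇒inRange (suc ℓ) v e)) v≤j
      (≤-trans enough (nbrCount-mono a b a j (X.I ℓ) (Y.I ℓ) v
        (λ a<v e′ → a<v , go ℓ (v ∸ 1) (≤-trans (m∸n≤m v 1) v≤j) e′) right))
    where
    right : (v <ᵇ b) ≡ true → X.I ℓ (suc v) ≡ true → (v <ᵇ j) ≡ true × Y.I ℓ (suc v) ≡ true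
    right _ e′ with m≤n⇒m<n∨m≡n v≤j
    ... | inj₁ v<j = <ᵇ-complete v<j , go ℓ (suc v) v<j e′
    ... | inj₂ refl with () ← trans (sym (no-earlier-right ℓ e′)) eℓ

influenced-restrictʳ : ∀ {a b k} t p →
  (∀ ℓ → Influenced a b t p ℓ (k ∸ 1) ≡ true → Influenced a b t p ℓ k ≡ true) →
  ∀ ℓ v → k ≤ v → Influenced a b t p ℓ v ≡ true → Influenced k b t p ℓ v ≡ true
influenced-restrictʳ {a} {b} {k} t p no-earlier-left = go
  where
  module X = Influence a b t p
  module Y = Influence k b t p
  go : ∀ ℓ v → k ≤ v → X.I ℓ v ≡ true → Y.I ℓ v ≡ true
  go zero v k≤v e = Y.seeded k≤v (proj₂ (X.influenced⇒inRange 0 v e)) (X.seeded⁻¹ v e)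
  go (suc ℓ) v k≤v e with X.I ℓ v in eℓ | X.step⁻¹ ℓ v e
  ... | true | _ = Y.influenced-suc ℓ v (go ℓ v k≤v eℓ)
  ... | false | inj₂ enough =
    Y.step ℓ k≤v (proj₂ (X.influenced⇒inRange (suc ℓ) v e))
      (≤-trans enough (nbrCount-mono a b k b (X.I ℓ) (Y.I ℓ) v
        left (λ v<b e′ → v<b , go ℓ (suc v) (m≤n⇒m≤1+n k≤v) e′)))
    where
    left : (a <ᵇ v) ≡ true → X.I ℓ (v ∸ 1) ≡ true → (k <ᵇ v) ≡ true × Y.I ℓ (v ∸ 1) ≡ true
    left _ e′ with m≤n⇒m<n∨m≡n k≤v
    ... | inj₁ k<v = <ᵇ-complete k<v , go ℓ (v ∸ 1) (pred-mono-≤ k<v) e′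
    ... | inj₂ refl with () ← trans (sym (no-earlier-left ℓ e′)) eℓ

admissible-[]≔ : ∀ {a b t p} w → Admissible a b t p → Admissible a b t (p [ w ]≔ t w)
admissible-[]≔ {t = t} {p} w admissible i a≤i i≤b with i ≡ᵇ w in eq
... | true = ≤-reflexive (cong t (sym (≡ᵇ-sound eq)))
... | false = admissible i a≤i i≤b

TBI-[]≔ : ∀ {a b} λ′ t p w → TBI λ′ a b t p → TBI λ′ a b t (p [ w ]≔ t w)
TBI-[]≔ λ′ t p w (admissible , all) =
  admissible-[]≔ w admissible ,
  λ v a≤v v≤b → influenced-widen t ≤-refl ≤-refl raised (admissible-[]≔ w admissible) λ′ v (all v a≤v v≤b)
  where
  raised : ∀ v → _ ≤ v → v ≤ _ → p v ≤ (p [ w ]≔ t w) v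
  raised v a≤v v≤b with v ≡ᵇ w in eq
  ... | true = subst (λ u → p v ≤ t u) (≡ᵇ-sound eq) (admissible v a≤v v≤b)
  ... | false = ≤-refl

TBI⇒TBI→ : ∀ {a b j} λ′ t p → j ≤ b → TBI λ′ a b t p →
  (∀ ℓ → Influenced a b t p ℓ (suc j) ≡ true → Influenced a b t p ℓ j ≡ true) →
  Influenced a b t p (λ′ ∸ 1) j ≡ true → TBI→ λ′ 1 a j t p
TBI⇒TBI→ λ′ t p j≤b (admissible , all) no-earlier-right j-in-time =
  ((λ i a≤i i≤j → admissible i a≤i (≤-trans i≤j j≤b)) ,
   λ v a≤v v≤j → restrict λ′ v v≤j (all v a≤v (≤-trans v≤j j≤b))) ,
  restrict (λ′ ∸ 1) _ ≤-refl j-in-time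
  where restrict = influenced-restrictˡ t p no-earlier-right

TBI⇒TBI← : ∀ {a b k} λ′ t p → a ≤ k → TBI λ′ a b t p →
  (∀ ℓ → Influenced a b t p ℓ (k ∸ 1) ≡ true → Influenced a b t p ℓ k ≡ true) →
  Influenced a b t p (λ′ ∸ 1) k ≡ true → TBI← λ′ 1 k b t p
TBI⇒TBI← λ′ t p a≤k (admissible , all) no-earlier-left k-in-time =
  ((λ i k≤i i≤b → admissible i (≤-trans a≤k k≤i) i≤b) ,
   λ v k≤v v≤b → restrict λ′ v k≤v (all v (≤-trans a≤k k≤v) v≤b)) ,
  restrict (λ′ ∸ 1) _ ≤-refl k-in-time
  where restrict = influenced-restrictʳ t p no-earlier-left

TBI-seed→ : ∀ {a b j} λ′ t p → a ≤ j → j ≤ b → TBI λ′ a b t p → TBI→ λ′ 1 a j t (p [ j ]≔ t j)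
TBI-seed→ {a} {b} {j} λ′ t p a≤j j≤b solution =
  TBI⇒TBI→ λ′ t q j≤b (TBI-[]≔ λ′ t p j solution) (λ ℓ _ → influenced-later j (z≤n {ℓ}) j-seeded)
    (influenced-later j (z≤n {λ′ ∸ 1}) j-seeded)
  where
  q = p [ j ]≔ t j
  open Influence a b t q
  j-seeded : I 0 j ≡ true
  j-seeded = seeded a≤j j≤b ([]≔-≡ p j (t j))

TBI-seed← : ∀ {a b k} λ′ t p → a ≤ k → k ≤ b → TBI λ′ a b t p → TBI← λ′ 1 k b t (p [ k ]≔ t k)
TBI-seed← {a} {b} {k} λ′ t p a≤k k≤b solution =
  TBI⇒TBI← λ′ t q a≤k (TBI-[]≔ λ′ t p k solution) (λ ℓ _ → influenced-later k (z≤n {ℓ}) k-seeded)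
    (influenced-later k (z≤n {λ′ ∸ 1}) k-seeded)
  where
  q = p [ k ]≔ t k
  open Influence a b t q
  k-seeded : I 0 k ≡ true
  k-seeded = seeded a≤k k≤b ([]≔-≡ p k (t k))

-- Existence of optimal incentives

Minimum : ((ℕ → ℕ) → ℕ) → ((ℕ → ℕ) → Set) → ℕ → Set
Minimum C P c = Σ (ℕ → ℕ) (λ p → P p × C p ≡ c) × (∀ p → P p → c ≤ C p)

MinimumOrEmpty : ((ℕ → ℕ) → ℕ) → ((ℕ → ℕ) → Set) → Set
MinimumOrEmpty C P = Σ ℕ (Minimum C P) ⊎ (∀ p → ¬ P p)

module _ {C : (ℕ → ℕ) → ℕ} {P Q : (ℕ → ℕ) → Set} where

  minimum-⇔ : ∀ {c} → (∀ p → P p → Q p) → (∀ p → Q p → P p) → Minimum C P c → Minimum C Q c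
  minimum-⇔ P⇒Q Q⇒P ((p , Pp , Cp≡c) , least) = (p , P⇒Q p Pp , Cp≡c) , λ q Qq → least q (Q⇒P q Qq)

  minimumOrEmpty-⇔ : (∀ p → P p → Q p) → (∀ p → Q p → P p) → MinimumOrEmpty C P → MinimumOrEmpty C Q
  minimumOrEmpty-⇔ P⇒Q Q⇒P (inj₁ (c , m)) = inj₁ (c , minimum-⇔ P⇒Q Q⇒P m)
  minimumOrEmpty-⇔ P⇒Q Q⇒P (inj₂ empty) = inj₂ λ q Qq → empty q (Q⇒P q Qq)

  minimum-∪ˡ : ∀ {c} → Minimum C P c → (∀ p → Q p → c ≤ C p) → Minimum C (λ p → P p ⊎ Q p) c
  minimum-∪ˡ ((p , Pp , Cp≡c) , least) below =
    (p , inj₁ Pp , Cp≡c) , λ { q (inj₁ Pq) → least q Pq ; q (inj₂ Qq) → below q Qq }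

  minimum-∪ʳ : ∀ {c} → (∀ p → P p → c ≤ C p) → Minimum C Q c → Minimum C (λ p → P p ⊎ Q p) c
  minimum-∪ʳ below ((p , Qp , Cp≡c) , least) =
    (p , inj₂ Qp , Cp≡c) , λ { q (inj₁ Pq) → below q Pq ; q (inj₂ Qq) → least q Qq }

  minimumOrEmpty-∪ : MinimumOrEmpty C P → MinimumOrEmpty C Q → MinimumOrEmpty C (λ p → P p ⊎ Q p)
  minimumOrEmpty-∪ (inj₁ (c₁ , m₁)) (inj₁ (c₂ , m₂)) with c₁ ≤? c₂
  ... | yes c₁≤c₂ = inj₁ (c₁ , minimum-∪ˡ m₁ λ q Qq → ≤-trans c₁≤c₂ (proj₂ m₂ q Qq))
  ... | no c₁≰c₂ = inj₁ (c₂ , minimum-∪ʳ (λ q Pq → ≤-trans (<⇒≤ (≰⇒> c₁≰c₂)) (proj₂ m₁ q Pq)) m₂)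
  minimumOrEmpty-∪ (inj₁ (c₁ , m₁)) (inj₂ noQ) = inj₁ (c₁ , minimum-∪ˡ m₁ λ q Qq → contradiction Qq (noQ q))
  minimumOrEmpty-∪ (inj₂ noP) (inj₁ (c₂ , m₂)) = inj₁ (c₂ , minimum-∪ʳ (λ q Pq → contradiction Pq (noP q)) m₂)
  minimumOrEmpty-∪ (inj₂ noP) (inj₂ noQ) = inj₂ λ { q (inj₁ Pq) → noP q Pq ; q (inj₂ Qq) → noQ q Qq }

window : ℕ → ℕ → (ℕ → ℕ) → ℕ
window x d p = ∑[ i < d ] p (x + i)

window-suc : ∀ x d p → window x (suc d) p ≡ p x + window (suc x) d p
window-suc x d p = cong₂ _+_ (cong p (+-identityʳ x)) (∑-cong d λ i _ → cong p (+-suc x i))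

Local : ℕ → ℕ → ((ℕ → ℕ) → Set) → Set
Local x d P = ∀ p q → (∀ v → x ≤ v → v < x + d → p v ≡ q v) → P p → P q

BoundedBy : (ℕ → ℕ) → ℕ → ℕ → ((ℕ → ℕ) → Set) → Set
BoundedBy t x d P = ∀ p → P p → ∀ v → x ≤ v → v < x + d → p v ≤ t v

module Slice {x d : ℕ} {P : (ℕ → ℕ) → Set} (local : Local x (suc d) P) (c : ℕ) where

  Fixed : (ℕ → ℕ) → Set
  Fixed q = P (q [ x ]≔ c)

  Slice : (ℕ → ℕ) → Set
  Slice p = P p × p x ≡ c

  above-x : ∀ {v} → suc x ≤ v → v ≢ x
  above-x x<v refl = <-irrefl refl x<v

  fixed-local : Local (suc x) d Fixed
  fixed-local p q p≗q = local (p [ x ]≔ c) (q [ x ]≔ c) agree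
    where
    agree : ∀ v → x ≤ v → v < x + suc d → (p [ x ]≔ c) v ≡ (q [ x ]≔ c) v
    agree v x≤v v<x+1+d with v ≟ x
    ... | yes refl = trans ([]≔-≡ p x c) (sym ([]≔-≡ q x c))
    ... | no v≢x =
      let x<v = ≤∧≢⇒< x≤v (v≢x ∘ sym) in
      trans ([]≔-≢ p c v≢x) (trans (p≗q v x<v (subst (v <_) (+-suc x d) v<x+1+d)) (sym ([]≔-≢ q c v≢x)))

  fixed-bounded : ∀ {t} → BoundedBy t x (suc d) P → BoundedBy t (suc x) d Fixed
  fixed-bounded bounded q Fq v x<v v<1+x+d =
    subst (_≤ _) ([]≔-≢ q c (above-x x<v))
      (bounded _ Fq v (<⇒≤ x<v) (subst (v <_) (sym (+-suc x d)) v<1+x+d))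

  slice⇒fixed : ∀ p → Slice p → Fixed p
  slice⇒fixed p (Pp , px≡c) = local p (p [ x ]≔ c) (λ v _ _ → sym (unchanged v)) Pp
    where
    unchanged : ∀ v → (p [ x ]≔ c) v ≡ p v
    unchanged v with v ≟ x
    ... | yes refl = trans ([]≔-≡ p x c) (sym px≡c)
    ... | no v≢x = []≔-≢ p c v≢x

  minimumOrEmpty-slice : MinimumOrEmpty (window (suc x) d) Fixed → MinimumOrEmpty (window x (suc d)) Slice
  minimumOrEmpty-slice (inj₂ noFixed) = inj₂ λ p Sp → noFixed p (slice⇒fixed p Sp)
  minimumOrEmpty-slice (inj₁ (c′ , (q , Fq , window≡c′) , least)) =
    inj₁ (c + c′ , (q [ x ]≔ c , (Fq , []≔-≡ q x c) , witness-cost) , λ p Sp → lower p Sp)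
    where
    witness-cost : window x (suc d) (q [ x ]≔ c) ≡ c + c′
    witness-cost = trans (window-suc x d (q [ x ]≔ c))
      (cong₂ _+_ ([]≔-≡ q x c)
        (trans (∑-cong d λ i _ → []≔-≢ q c (above-x (s≤s (m≤m+n x i)))) window≡c′))
    lower : ∀ p → Slice p → c + c′ ≤ window x (suc d) p
    lower p Sp@(_ , px≡c) = subst (c + c′ ≤_) (sym (window-suc x d p))
      (+-mono-≤ (≤-reflexive (sym px≡c)) (least p (slice⇒fixed p Sp)))

bounded-minimum : ∀ d x t {P} → (∀ p → Dec (P p)) → Local x d P → BoundedBy t x d P →
  MinimumOrEmpty (window x d) P
bounded-minimum zero x t {P} P? local _ with P? (λ _ → 0)
... | yes P0 = inj₁ (0 , ((λ _ → 0) , P0 , refl) , λ _ _ → z≤n)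
... | no ¬P0 = inj₂ λ p Pp → ¬P0 (local p _ (λ v x≤v v<x → ⊥-elim (nothing-in-range v x≤v v<x)) Pp)
  where
  nothing-in-range : ∀ v → x ≤ v → v < x + 0 → ⊥
  nothing-in-range v x≤v v<x = ≤⇒≯ x≤v (subst (v <_) (+-identityʳ x) v<x)
bounded-minimum (suc d) x t {P} P? local bounded =
  minimumOrEmpty-⇔ (λ _ → proj₁) (λ p Pp → Pp , bounded p Pp x ≤-refl (m<m+n x z<s)) (capped (t x))
  where
  slice : ∀ c → MinimumOrEmpty (window x (suc d)) (Slice.Slice local c)
  slice c = Slice.minimumOrEmpty-slice local c
    (bounded-minimum d (suc x) t (λ q → P? (q [ x ]≔ c))
      (Slice.fixed-local local c) (Slice.fixed-bounded local c bounded))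
  capped : ∀ B → MinimumOrEmpty (window x (suc d)) (λ p → P p × p x ≤ B)
  capped zero =
    minimumOrEmpty-⇔ (λ _ (Pp , px≡0) → Pp , ≤-reflexive px≡0) (λ _ (Pp , px≤0) → Pp , n≤0⇒n≡0 px≤0) (slice 0)
  capped (suc B) = minimumOrEmpty-⇔ merge split (minimumOrEmpty-∪ (capped B) (slice (suc B)))
    where
    merge : ∀ p → (P p × p x ≤ B) ⊎ (P p × p x ≡ suc B) → P p × p x ≤ suc B
    merge _ (inj₁ (Pp , px≤B)) = Pp , m≤n⇒m≤1+n px≤B
    merge _ (inj₂ (Pp , px≡1+B)) = Pp , ≤-reflexive px≡1+B
    split : ∀ p → P p × p x ≤ suc B → (P p × p x ≤ B) ⊎ (P p × p x ≡ suc B)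
    split _ (Pp , px≤1+B) with m≤n⇒m<n∨m≡n px≤1+B
    ... | inj₁ px<1+B = inj₁ (Pp , s≤s⁻¹ px<1+B)
    ... | inj₂ px≡1+B = inj₂ (Pp , px≡1+B)

TBI? : ∀ λ′ a b t p → Dec (TBI λ′ a b t p)
TBI? λ′ a b t p =
  all-inRange? a b (λ i → p i ≤? t i) ×-dec all-inRange? a b (λ v → Influenced a b t p λ′ v ≟ᵇ true)

TBI-all-seeded : ∀ λ′ a b t → TBI λ′ a b t t
TBI-all-seeded λ′ a b t =
  (λ _ _ _ → ≤-refl) , λ v a≤v v≤b → influenced-later v (z≤n {λ′}) (seeded a≤v v≤b refl)
  where open Influence a b t t

module _ {a b : ℕ} {t p q : ℕ → ℕ} (p≗q : ∀ v → a ≤ v → v ≤ b → p v ≡ q v) where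

  admissible-cong : Admissible a b t p → Admissible a b t q
  admissible-cong admissible i a≤i i≤b = subst (_≤ t i) (p≗q i a≤i i≤b) (admissible i a≤i i≤b)

  influenced-cong : Admissible a b t p →
    ∀ ℓ v → Influenced a b t p ℓ v ≡ true → Influenced a b t q ℓ v ≡ true
  influenced-cong admissible =
    influenced-widen t ≤-refl ≤-refl (λ v a≤v v≤b → ≤-reflexive (p≗q v a≤v v≤b)) (admissible-cong admissible)

optimum-exists : ∀ λ′ a b t ℓ w → a ≤ w → w ≤ b →
  Σ ℕ (IsOpt a b (λ p → TBI λ′ a b t p × Influenced a b t p ℓ w ≡ true))
optimum-exists λ′ a b t ℓ w a≤w w≤b = extract (bounded-minimum (suc (b ∸ a)) a t P? local bounded)
  where
  P : (ℕ → ℕ) → Set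
  P p = TBI λ′ a b t p × Influenced a b t p ℓ w ≡ true
  P? : ∀ p → Dec (P p)
  P? p = TBI? λ′ a b t p ×-dec (Influenced a b t p ℓ w ≟ᵇ true)
  span : a + suc (b ∸ a) ≡ suc b
  span = trans (+-suc a (b ∸ a)) (cong suc (m+[n∸m]≡n (≤-trans a≤w w≤b)))
  local : Local a (suc (b ∸ a)) P
  local p q p≗q ((admissible , all) , w-in-time) =
    (admissible-cong agree admissible , λ v a≤v v≤b → influenced-cong agree admissible λ′ v (all v a≤v v≤b)) ,
    influenced-cong agree admissible ℓ w w-in-time
    where
    agree : ∀ v → a ≤ v → v ≤ b → p v ≡ q v
    agree v a≤v v≤b = p≗q v a≤v (subst (v <_) (sym span) (s≤s v≤b))
  bounded : BoundedBy t a (suc (b ∸ a)) P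
  bounded p ((admissible , _) , _) v a≤v v<end = admissible v a≤v (s≤s⁻¹ (subst (v <_) span v<end))
  extract : MinimumOrEmpty (window a (suc (b ∸ a))) P → Σ ℕ (IsOpt a b P)
  extract (inj₁ (c , (p , Pp , window≡c) , least)) =
    c , (p , Pp , trans (cost-∑ a b p) window≡c) , λ q Pq → subst (c ≤_) (sym (cost-∑ a b q)) (least q Pq)
  extract (inj₂ empty) =
    contradiction (TBI-all-seeded λ′ a b t , influenced-later w (z≤n {ℓ}) (seeded a≤w w≤b refl)) (empty t)
    where open Influence a b t t

-- Lower bound

firstTrue : (ℕ → Bool) → ℕ → ℕ
firstTrue f zero = 0
firstTrue f (suc n) = if f 0 then 0 else suc (firstTrue (f ∘ suc) n)

firstTrue-≤ : ∀ (f : ℕ → Bool) n → firstTrue f n ≤ n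
firstTrue-≤ f zero = z≤n
firstTrue-≤ f (suc n) with f 0
... | true = z≤n
... | false = s≤s (firstTrue-≤ (f ∘ suc) n)

firstTrue-true : ∀ (f : ℕ → Bool) n → f n ≡ true → f (firstTrue f n) ≡ true
firstTrue-true f zero e = e
firstTrue-true f (suc n) e with f 0 in e0
... | true = e0
... | false = firstTrue-true (f ∘ suc) n e

firstTrue-least : ∀ (f : ℕ → Bool) n ℓ → ℓ ≤ n → f ℓ ≡ true → firstTrue f n ≤ ℓ
firstTrue-least f zero ℓ _ _ = z≤n
firstTrue-least f (suc n) ℓ ℓ≤n e with f 0 in e0
... | true = z≤n
firstTrue-least f (suc n) zero _ e | false with () ← trans (sym e0) e
firstTrue-least f (suc n) (suc ℓ) ℓ≤n e | false = s≤s (firstTrue-least (f ∘ suc) n ℓ (s≤s⁻¹ ℓ≤n) e)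

module Telescope (E : ℕ → ℕ → ℕ) (one-way : ∀ u → E (suc u) u + E u (suc u) ≤ 1) where

  inflow : ℕ → ℕ
  inflow v = E (v ∸ 1) v + E (suc v) v

  telescope : ∀ m x →
    ∑[ i < suc m ] inflow (suc (x + i)) ≤ E x (suc x) + m + E (suc (suc (x + m))) (suc (x + m))
  telescope zero x rewrite +-identityʳ x = ≤-reflexive (shuffle (E x (suc x)) _)
    where
    shuffle : ∀ e f → e + f + 0 ≡ e + 0 + f
    shuffle = solve-∀
  telescope (suc m) x = begin
    inflow (suc (x + 0)) + ∑[ i < suc m ] inflow (suc (x + suc i))
      ≡⟨ cong₂ _+_ (cong (inflow ∘ suc) (+-identityʳ x)) (∑-cong (suc m) λ i _ → cong (inflow ∘ suc) (+-suc x i)) ⟩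
    inflow (suc x) + ∑[ i < suc m ] inflow (suc (suc x + i))
      ≤⟨ +-monoʳ-≤ (inflow (suc x)) (telescope m (suc x)) ⟩
    E x (suc x) + E (suc (suc x)) (suc x) + (E (suc x) (suc (suc x)) + m + R)
      ≡⟨ shuffle (E x (suc x)) (E (suc (suc x)) (suc x)) _ m R ⟩
    E x (suc x) + (E (suc (suc x)) (suc x) + E (suc x) (suc (suc x))) + m + R
      ≤⟨ +-monoˡ-≤ R (+-monoˡ-≤ m (+-monoʳ-≤ (E x (suc x)) (one-way (suc x)))) ⟩
    E x (suc x) + 1 + m + R
      ≡⟨ cong₂ _+_ (shift (E x (suc x)) m) (cong (λ z → E (suc (suc z)) (suc z)) (sym (+-suc x m))) ⟩
    E x (suc x) + suc m + E (suc (suc (x + suc m))) (suc (x + suc m))  ∎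
    where
    open ≤-Reasoning
    R = E (suc (suc (suc x + m))) (suc (suc x + m))
    shuffle : ∀ e f g m r → e + f + (g + m + r) ≡ e + (f + g) + m + r
    shuffle = solve-∀
    shift : ∀ e m → e + 1 + m ≡ e + suc m
    shift = solve-∀

combine-bounds : ∀ β δ A B cL cM cR m′ → β + A ≤ cL + 1 → δ + B ≤ cR + 1 → 2 * suc m′ ≤ cM + (A + m′ + B) →
  β + m′ + δ ≤ cL + cM + cR
combine-bounds β δ A B cL cM cR m′ left right interior =
  +-cancelʳ-≤ (A + B + 2 + m′) (β + m′ + δ) (cL + cM + cR)
    (subst₂ _≤_ (lhs β δ A B m′) (rhs A B cL cM cR m′) (+-mono-≤ (+-mono-≤ left right) interior))
  where
  lhs : ∀ β δ A B m′ → β + A + (δ + B) + 2 * suc m′ ≡ β + m′ + δ + (A + B + 2 + m′)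
  lhs = solve-∀
  rhs : ∀ A B cL cM cR m′ → cL + 1 + (cR + 1) + (cM + (A + m′ + B)) ≡ cL + cM + cR + (A + B + 2 + m′)
  rhs = solve-∀

module LowerBound {a b : ℕ} (λ′ : ℕ) (t p : ℕ → ℕ) (solution : TBI λ′ a b t p) where

  open Influence a b t p

  τ : ℕ → ℕ
  τ v = firstTrue (λ ℓ → I ℓ v) λ′

  τ-least : ∀ v ℓ → I ℓ v ≡ true → τ v ≤ ℓ
  τ-least v ℓ e with ℓ ≤? λ′
  ... | yes ℓ≤λ = firstTrue-least _ λ′ ℓ ℓ≤λ e
  ... | no ℓ≰λ = ≤-trans (firstTrue-≤ _ λ′) (<⇒≤ (≰⇒> ℓ≰λ))

  influenced-from-τ : ∀ v ℓ → a ≤ v → v ≤ b → τ v ≤ ℓ → I ℓ v ≡ true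
  influenced-from-τ v ℓ a≤v v≤b τ≤ℓ =
    influenced-later v τ≤ℓ (firstTrue-true (λ ℓ → I ℓ v) λ′ (proj₂ solution v a≤v v≤b))

  earlier : ℕ → ℕ → ℕ
  earlier u v = indicator (τ u <ᵇ τ v)

  earlier-one-way : ∀ u → earlier (suc u) u + earlier u (suc u) ≤ 1
  earlier-one-way u with τ (suc u) <ᵇ τ u in e₁ | τ u <ᵇ τ (suc u) in e₂
  ... | true | true = contradiction (<ᵇ-sound {τ u} e₂) (<⇒≯ (<ᵇ-sound {τ (suc u)} e₁))
  ... | true | false = ≤-refl
  ... | false | true = ≤-refl
  ... | false | false = z≤n

  open Telescope earlier earlier-one-way

  deficit≤inflow : ∀ v → a ≤ v → v ≤ b → t v ∸ p v ≤ inflow v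
  deficit≤inflow v a≤v v≤b with τ v in τv≡ | influenced-from-τ v (τ v) a≤v v≤b ≤-refl
  ... | zero | e rewrite seeded⁻¹ v e | n∸n≡0 (t v) = z≤n
  ... | suc r | e with step⁻¹ r v e
  ...   | inj₁ e′ = contradiction (subst (_≤ r) τv≡ (τ-least v r e′)) 1+n≰n
  ...   | inj₂ enough = ≤-trans enough (+-mono-≤ (indicator-mono from-left) (indicator-mono from-right))
    where
    from-left : ((a <ᵇ v) ∧ I r (v ∸ 1)) ≡ true → (τ (v ∸ 1) <ᵇ suc r) ≡ true
    from-left e′ = <ᵇ-complete (s≤s (τ-least (v ∸ 1) r (∧-elimʳ (a <ᵇ v) e′)))
    from-right : ((v <ᵇ b) ∧ I r (suc v)) ≡ true → (τ (suc v) <ᵇ suc r) ≡ true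
    from-right e′ = <ᵇ-complete (s≤s (τ-least (suc v) r (∧-elimʳ (v <ᵇ b) e′)))

  in-time : ∀ {u v} → τ u < τ v → τ u ≤ λ′ ∸ 1
  in-time τu<τv = ∸-monoˡ-≤ 1 (≤-trans τu<τv (firstTrue-≤ _ λ′))

  left-bound : ∀ j → a ≤ j → j < b → t j ≡ 1 → ∀ {β} → (∀ q → TBI→ λ′ 1 a j t q → β ≤ cost a j q) →
    β + earlier j (suc j) ≤ cost a j p + 1
  left-bound j a≤j j<b tj≡1 {β} β-least with τ j <ᵇ τ (suc j) in τj<τj+1
  ... | true = +-monoˡ-≤ 1 (β-least p (TBI⇒TBI→ λ′ t p j≤b solution no-earlier-right
                 (influenced-from-τ j (λ′ ∸ 1) a≤j j≤b (in-time (<ᵇ-sound {τ j} τj<τj+1)))))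
    where
    j≤b = <⇒≤ j<b
    no-earlier-right : ∀ ℓ → I ℓ (suc j) ≡ true → I ℓ j ≡ true
    no-earlier-right ℓ e =
      influenced-from-τ j ℓ a≤j j≤b (≤-trans (<⇒≤ (<ᵇ-sound {τ j} τj<τj+1)) (τ-least (suc j) ℓ e))
  ... | false = begin
    β + 0                          ≡⟨ +-identityʳ β ⟩
    β                              ≤⟨ β-least _ (TBI-seed→ λ′ t p a≤j (<⇒≤ j<b) solution) ⟩
    cost a j (p [ j ]≔ t j)        ≤⟨ cost-[]≔-≤ p (t j) a≤j ≤-refl ⟩
    cost a j p + t j               ≡⟨ cong (cost a j p +_) tj≡1 ⟩
    cost a j p + 1                 ∎
    where open ≤-Reasoning

  right-bound : ∀ k → a < k → k ≤ b → t k ≡ 1 → ∀ {δ} → (∀ q → TBI← λ′ 1 k b t q → δ ≤ cost k b q) →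
    δ + earlier k (k ∸ 1) ≤ cost k b p + 1
  right-bound k a<k k≤b tk≡1 {δ} δ-least with τ k <ᵇ τ (k ∸ 1) in τk<τk-1
  ... | true = +-monoˡ-≤ 1 (δ-least p (TBI⇒TBI← λ′ t p a≤k solution no-earlier-left
                 (influenced-from-τ k (λ′ ∸ 1) a≤k k≤b (in-time (<ᵇ-sound {τ k} τk<τk-1)))))
    where
    a≤k = <⇒≤ a<k
    no-earlier-left : ∀ ℓ → I ℓ (k ∸ 1) ≡ true → I ℓ k ≡ true
    no-earlier-left ℓ e =
      influenced-from-τ k ℓ a≤k k≤b (≤-trans (<⇒≤ (<ᵇ-sound {τ k} τk<τk-1)) (τ-least (k ∸ 1) ℓ e))
  ... | false = begin
    δ + 0                          ≡⟨ +-identityʳ δ ⟩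
    δ                              ≤⟨ δ-least _ (TBI-seed← λ′ t p (<⇒≤ a<k) k≤b solution) ⟩
    cost k b (p [ k ]≔ t k)        ≤⟨ cost-[]≔-≤ p (t k) ≤-refl k≤b ⟩
    cost k b p + t k               ≡⟨ cong (cost k b p +_) tk≡1 ⟩
    cost k b p + 1                 ∎
    where open ≤-Reasoning

  interior-bound : ∀ j m′ → a ≤ j → suc (j + m′) < b → (∀ i → i < suc m′ → t (suc (j + i)) ≡ 2) →
    2 * suc m′ ≤
      cost (suc j) (suc (j + m′)) p + (earlier j (suc j) + m′ + earlier (suc (suc (j + m′))) (suc (j + m′)))
  interior-bound j m′ a≤j y<b two = begin
    2 * suc m′                                 ≡⟨ trans (*-comm 2 (suc m′)) (sym (∑-const (suc m′) 2)) ⟩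
    ∑[ i < suc m′ ] 2                          ≤⟨ ∑-mono (suc m′) paid-or-helped ⟩
    ∑[ i < suc m′ ] (p (v i) + inflow (v i))   ≡⟨ ∑-distrib-+ (suc m′) (p ∘ v) (inflow ∘ v) ⟩
    paid + ∑[ i < suc m′ ] inflow (v i)        ≤⟨ +-monoʳ-≤ paid (telescope m′ j) ⟩
    paid + slack                               ≡⟨ cong (_+ slack) (cost-from (suc j) m′ p) ⟨
    cost (suc j) (suc (j + m′)) p + slack      ∎
    where
    open ≤-Reasoning
    v : ℕ → ℕ
    v i = suc (j + i)
    paid slack : ℕ
    paid = ∑[ i < suc m′ ] p (v i)
    slack = earlier j (suc j) + m′ + earlier (suc (suc (j + m′))) (suc (j + m′))
    paid-or-helped : ∀ i → i < suc m′ → 2 ≤ p (v i) + inflow (v i)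
    paid-or-helped i i<m = begin
      2                              ≡⟨ two i i<m ⟨
      t (v i)                        ≤⟨ m≤n+m∸n (t (v i)) (p (v i)) ⟩
      p (v i) + (t (v i) ∸ p (v i))  ≤⟨ +-monoʳ-≤ (p (v i)) (deficit≤inflow (v i) a≤v v≤b) ⟩
      p (v i) + inflow (v i)         ∎
      where
      a≤v = ≤-trans a≤j (≤-trans (m≤m+n j i) (n≤1+n _))
      v≤b = <⇒≤ (≤-<-trans (s≤s (+-monoʳ-≤ j (s≤s⁻¹ i<m))) y<b)

  lower-bound : ∀ j m′ → a ≤ j → suc (suc (j + m′)) ≤ b → TwoPath t j (suc (suc (j + m′))) →
    ∀ {β δ} → (∀ q → TBI→ λ′ 1 a j t q → β ≤ cost a j q) →
    (∀ q → TBI← λ′ 1 (suc (suc (j + m′))) b t q → δ ≤ cost (suc (suc (j + m′))) b q) →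
    β + m′ + δ ≤ cost a b p
  lower-bound j m′ a≤j k≤b (_ , tj≡1 , tk≡1 , interior-2) {β} {δ} β-least δ-least =
    subst (β + m′ + δ ≤_) (sym (cost-split₃ p a≤j j<y k≤b))
      (combine-bounds β δ _ _ (cost a j p) _ (cost k b p) m′
        (left-bound j a≤j (<-trans j<y k≤b) tj≡1 β-least)
        (right-bound k (s≤s (≤-trans a≤j (≤-trans (m≤m+n j m′) (n≤1+n _)))) k≤b tk≡1 δ-least)
        (interior-bound j m′ a≤j k≤b λ i i<m →
          interior-2 _ (s≤s (m≤m+n j i)) (s≤s (s≤s (+-monoʳ-≤ j (s≤s⁻¹ i<m))))))
    where
    k = suc (suc (j + m′))
    j<y : j < suc (j + m′)
    j<y = s≤s (m≤m+n j m′)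

-- Upper bound

gadget : ℕ → ℕ → ℕ
gadget 2 1 = 1
gadget 2 _ = 0
gadget (suc (suc m)) 1 = 0
gadget (suc (suc m)) 2 = 2
gadget (suc (suc m)) (suc (suc i)) = gadget m i
gadget _ _ = 0

gadget-≤2 : ∀ m i → gadget m i ≤ 2
gadget-≤2 2 1 = s≤s z≤n
gadget-≤2 2 0 = z≤n
gadget-≤2 2 (suc (suc i)) = z≤n
gadget-≤2 (suc (suc (suc m))) 0 = z≤n
gadget-≤2 (suc (suc (suc m))) 1 = z≤n
gadget-≤2 (suc (suc (suc m))) 2 = ≤-refl
gadget-≤2 (suc (suc (suc m))) (suc (suc (suc i))) = gadget-≤2 (suc m) (suc i)
gadget-≤2 0 _ = z≤n
gadget-≤2 1 _ = z≤n

gadget-sum : ∀ m′ → ∑[ i < suc m′ ] gadget (suc m′) (suc i) ≡ m′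
gadget-sum 0 = refl
gadget-sum 1 = refl
gadget-sum (suc (suc m₀)) = cong (2 +_) (gadget-sum m₀)

Relay : ℕ → ℕ → Set
Relay m i = 2 ≤ i × i ≤ m × gadget m i ≡ 1 × gadget m (i ∸ 1) ≡ 2

-- Offsets 0 and suc m stand for the ends j and k of the 2-path; Early m i says that the
-- node at offset i is influenced by round λ - 1.
Early : ℕ → ℕ → Set
Early m i = i ≡ 0 ⊎ i ≡ suc m ⊎ (1 ≤ i × i ≤ m × gadget m i ≡ 2) ⊎ Relay m i

OnTime : ℕ → ℕ → Set
OnTime m i = gadget m i ≡ 2 ⊎ Relay m i ⊎ (gadget m i ≡ 0 × Early m (i ∸ 1) × Early m (suc i))

early-shift : ∀ m₀ i → Early (suc m₀) i → Early (suc (suc (suc m₀))) (suc (suc i))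
early-shift m₀ i (inj₁ refl) = inj₂ (inj₂ (inj₁ (s≤s z≤n , s≤s (s≤s z≤n) , refl)))
early-shift m₀ i (inj₂ (inj₁ refl)) = inj₂ (inj₁ refl)
early-shift m₀ (suc i) (inj₂ (inj₂ (inj₁ (_ , i≤m , g)))) = inj₂ (inj₂ (inj₁ (s≤s z≤n , s≤s (s≤s i≤m) , g)))
early-shift m₀ 1 (inj₂ (inj₂ (inj₂ (s≤s () , _))))
early-shift m₀ (suc (suc i)) (inj₂ (inj₂ (inj₂ (_ , i≤m , g , g′)))) =
  inj₂ (inj₂ (inj₂ (s≤s (s≤s z≤n) , s≤s (s≤s i≤m) , g , g′)))

onTime-step : ∀ m₀ → (∀ i → 1 ≤ i → i ≤ suc m₀ → OnTime (suc m₀) i) →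
  ∀ i → 1 ≤ i → i ≤ suc (suc (suc m₀)) → OnTime (suc (suc (suc m₀))) i
onTime-step m₀ inner 1 _ _ = inj₂ (inj₂ (refl , inj₁ refl , inj₂ (inj₂ (inj₁ (s≤s z≤n , s≤s (s≤s z≤n) , refl)))))
onTime-step m₀ inner 2 _ _ = inj₁ refl
onTime-step m₀ inner (suc (suc (suc i))) _ (s≤s (s≤s i<m)) with inner (suc i) (s≤s z≤n) i<m
... | inj₁ g = inj₁ g
... | inj₂ (inj₁ (s≤s (s≤s _) , i≤m , g , g′)) = inj₂ (inj₁ (s≤s (s≤s z≤n) , s≤s (s≤s i≤m) , g , g′))
... | inj₂ (inj₂ (g , left , right)) =
  inj₂ (inj₂ (g , early-shift m₀ i left , early-shift m₀ (suc (suc i)) right))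

onTime : ∀ m → m ≢ 2 → ∀ i → 1 ≤ i → i ≤ m → OnTime m i
onTime 1 _ 1 _ _ = inj₂ (inj₂ (refl , inj₁ refl , inj₂ (inj₁ refl)))
onTime 1 _ (suc (suc _)) _ (s≤s ())
onTime 2 m≢2 _ _ _ = contradiction refl m≢2
onTime 3 _ = onTime-step 0 (onTime 1 λ ())
onTime 4 _ 1 _ _ = inj₂ (inj₂ (refl , inj₁ refl , inj₂ (inj₂ (inj₁ (s≤s z≤n , s≤s (s≤s z≤n) , refl)))))
onTime 4 _ 2 _ _ = inj₁ refl
onTime 4 _ 3 _ _ = inj₂ (inj₁ (s≤s (s≤s z≤n) , s≤s (s≤s (s≤s z≤n)) , refl , refl))
onTime 4 _ 4 _ _ =
  inj₂ (inj₂ (refl , inj₂ (inj₂ (inj₂ (s≤s (s≤s z≤n) , s≤s (s≤s (s≤s z≤n)) , refl , refl))) , inj₂ (inj₁ refl)))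
onTime 4 _ (suc (suc (suc (suc (suc _))))) _ (s≤s (s≤s (s≤s (s≤s ()))))
onTime (suc (suc (suc (suc (suc m₂))))) _ = onTime-step (suc (suc m₂)) (onTime (suc (suc (suc m₂))) λ ())

module UpperBound {L₁ a b : ℕ} (t : ℕ → ℕ) (1≤L₁ : 1 ≤ L₁) {j m′ : ℕ} (a≤j : a ≤ j)
  (k≤b : suc (suc (j + m′)) ≤ b) (m≢2 : suc m′ ≢ 2)
  (interior-2 : ∀ i → j < i → i < suc (suc (j + m′)) → t i ≡ 2)
  {pb pd : ℕ → ℕ} (left-ok : TBI→ (suc L₁) 1 a j t pb)
  (right-ok : TBI← (suc L₁) 1 (suc (suc (j + m′))) b t pd) where

  m k : ℕ
  m = suc m′
  k = suc (suc (j + m′))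

  j+1+m≡k : j + suc m ≡ k
  j+1+m≡k = trans (+-suc j m) (cong suc (+-suc j m′))

  j<k : j < k
  j<k = s≤s (≤-trans (m≤m+n j m′) (n≤1+n _))

  j+i<k : ∀ i → i ≤ m → j + i < k
  j+i<k i i≤m = subst (j + i <_) j+1+m≡k (+-monoʳ-< j (s≤s i≤m))

  glued : ℕ → ℕ
  glued v = if v ≤ᵇ j then pb v else if v <ᵇ k then gadget m (v ∸ j) else pd v

  glued-left : ∀ v → v ≤ j → glued v ≡ pb v
  glued-left v v≤j rewrite ≤ᵇ-complete v≤j = refl

  glued-right : ∀ v → k ≤ v → glued v ≡ pd v
  glued-right v k≤v
    rewrite ≢true⇒≡false {v ≤ᵇ j} (λ e → <⇒≱ (<-≤-trans j<k k≤v) (≤ᵇ-sound e))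
          | ≢true⇒≡false {v <ᵇ k} (λ e → <⇒≱ (<ᵇ-sound {v} e) k≤v) = refl

  glued-interior : ∀ i → 1 ≤ i → i ≤ m → glued (j + i) ≡ gadget m i
  glued-interior i 1≤i i≤m
    rewrite ≢true⇒≡false {j + i ≤ᵇ j} (λ e → <⇒≱ (m<m+n j 1≤i) (≤ᵇ-sound e))
          | <ᵇ-complete (j+i<k i i≤m) | m+n∸m≡n j i = refl

  interior-decomposition : ∀ v → ¬ v ≤ j → v < k → Σ ℕ λ i → v ≡ j + i × 1 ≤ i × i ≤ m
  interior-decomposition v v≰j v<k with m≤n⇒∃[o]m+o≡n (≰⇒> v≰j)
  ... | o , refl = suc o , sym (+-suc j o) , s≤s z≤n , s≤s (+-cancelˡ-≤ j o m′ (s≤s⁻¹ (s≤s⁻¹ v<k)))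

  interior-threshold : ∀ i → 1 ≤ i → i ≤ m → t (j + i) ≡ 2
  interior-threshold i 1≤i i≤m = interior-2 (j + i) (m<m+n j 1≤i) (j+i<k i i≤m)

  a≤j+i : ∀ i → a ≤ j + i
  a≤j+i i = ≤-trans a≤j (m≤m+n j i)

  j+i≤b : ∀ i → i ≤ m → j + i ≤ b
  j+i≤b i i≤m = <⇒≤ (<-≤-trans (j+i<k i i≤m) k≤b)

  glued-admissible : Admissible a b t glued
  glued-admissible v a≤v v≤b with v ≤? j | k ≤? v
  ... | yes v≤j | _ = subst (_≤ t v) (sym (glued-left v v≤j)) (proj₁ (proj₁ left-ok) v a≤v v≤j)
  ... | no _ | yes k≤v = subst (_≤ t v) (sym (glued-right v k≤v)) (proj₁ (proj₁ right-ok) v k≤v v≤b)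
  ... | no v≰j | no k≰v with interior-decomposition v v≰j (≰⇒> k≰v)
  ...   | i , refl , 1≤i , i≤m =
    subst₂ _≤_ (sym (glued-interior i 1≤i i≤m)) (sym (interior-threshold i 1≤i i≤m)) (gadget-≤2 m i)

  open Influence a b t glued

  influenced-left : ∀ ℓ v → Influenced a j t pb ℓ v ≡ true → I ℓ v ≡ true
  influenced-left = influenced-widen t ≤-refl (≤-trans (<⇒≤ j<k) k≤b)
    (λ v _ v≤j → ≤-reflexive (sym (glued-left v v≤j)))
    (λ v a≤v v≤j → glued-admissible v a≤v (≤-trans v≤j (≤-trans (<⇒≤ j<k) k≤b)))

  influenced-right : ∀ ℓ v → Influenced k b t pd ℓ v ≡ true → I ℓ v ≡ true
  influenced-right = influenced-widen t (≤-trans a≤j (<⇒≤ j<k)) ≤-refl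
    (λ v k≤v _ → ≤-reflexive (sym (glued-right v k≤v)))
    (λ v k≤v v≤b → glued-admissible v (≤-trans a≤j (≤-trans (<⇒≤ j<k) k≤v)) v≤b)

  step-interior : ∀ ℓ i → 1 ≤ i → i ≤ m →
    t (j + i) ∸ glued (j + i) ≤ indicator (I ℓ (j + (i ∸ 1))) + indicator (I ℓ (j + suc i)) →
    I (suc ℓ) (j + i) ≡ true
  step-interior ℓ (suc i) 1≤i i≤m enough =
    step ℓ (a≤j+i (suc i)) (j+i≤b (suc i) i≤m) (subst (t (j + suc i) ∸ glued (j + suc i) ≤_) neighbours enough)
    where
    neighbours : indicator (I ℓ (j + i)) + indicator (I ℓ (j + suc (suc i))) ≡ nbrCount a b (I ℓ) (j + suc i)
    neighbours
      rewrite <ᵇ-complete (<-≤-trans (s≤s (a≤j+i i)) (≤-reflexive (sym (+-suc j i))))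
            | <ᵇ-complete (<-≤-trans (j+i<k (suc i) i≤m) k≤b)
      = cong₂ _+_ (cong (indicator ∘ I ℓ) (cong (_∸ 1) (sym (+-suc j i))))
                  (cong (indicator ∘ I ℓ) (+-suc j (suc i)))

  interior-deficit : ∀ i → 1 ≤ i → i ≤ m → t (j + i) ∸ glued (j + i) ≡ 2 ∸ gadget m i
  interior-deficit i 1≤i i≤m = cong₂ _∸_ (interior-threshold i 1≤i i≤m) (glued-interior i 1≤i i≤m)

  seed-influenced : ∀ i → 1 ≤ i → i ≤ m → gadget m i ≡ 2 → I 0 (j + i) ≡ true
  seed-influenced i 1≤i i≤m g = seeded (a≤j+i i) (j+i≤b i i≤m)
    (trans (glued-interior i 1≤i i≤m) (trans g (sym (interior-threshold i 1≤i i≤m))))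

  early-influenced : ∀ i → Early m i → I L₁ (j + i) ≡ true
  early-influenced i (inj₁ refl) =
    subst (λ v → I L₁ v ≡ true) (sym (+-identityʳ j)) (influenced-left L₁ j (proj₂ left-ok))
  early-influenced i (inj₂ (inj₁ refl)) =
    subst (λ v → I L₁ v ≡ true) (sym j+1+m≡k) (influenced-right L₁ k (proj₂ right-ok))
  early-influenced i (inj₂ (inj₂ (inj₁ (1≤i , i≤m , g)))) =
    influenced-later (j + i) (z≤n {L₁}) (seed-influenced i 1≤i i≤m g)
  early-influenced (suc i) (inj₂ (inj₂ (inj₂ (s≤s 1≤i , i<m , g , g′)))) =
    influenced-later (j + suc i) 1≤L₁ (step-interior 0 (suc i) (s≤s z≤n) i<m (begin
      t (j + suc i) ∸ glued (j + suc i)   ≡⟨ trans (interior-deficit (suc i) (s≤s z≤n) i<m) (cong (2 ∸_) g) ⟩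
      1                                    ≤⟨ 1≤indicator (seed-influenced i 1≤i (≤-trans (n≤1+n i) i<m) g′) ⟩
      indicator (I 0 (j + i))              ≤⟨ m≤m+n _ _ ⟩
      indicator (I 0 (j + i)) + indicator (I 0 (j + suc (suc i))) ∎))
    where open ≤-Reasoning

  interior-influenced : ∀ i → 1 ≤ i → i ≤ m → I (suc L₁) (j + i) ≡ true
  interior-influenced i 1≤i i≤m with onTime m m≢2 i 1≤i i≤m
  ... | inj₁ g = influenced-later (j + i) (z≤n {suc L₁}) (seed-influenced i 1≤i i≤m g)
  ... | inj₂ (inj₁ relay) = influenced-suc L₁ (j + i) (early-influenced i (inj₂ (inj₂ (inj₂ relay))))
  ... | inj₂ (inj₂ (g , left , right)) = step-interior L₁ i 1≤i i≤m (begin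
    t (j + i) ∸ glued (j + i)                                        ≡⟨ trans (interior-deficit i 1≤i i≤m) (cong (2 ∸_) g) ⟩
    2                                                                ≤⟨ +-mono-≤ (1≤indicator (early-influenced (i ∸ 1) left))
                                                                                  (1≤indicator (early-influenced (suc i) right)) ⟩
    indicator (I L₁ (j + (i ∸ 1))) + indicator (I L₁ (j + suc i))   ∎)
    where open ≤-Reasoning

  glued-TBI : TBI (suc L₁) a b t glued
  glued-TBI = glued-admissible , all-influenced
    where
    all-influenced : ∀ v → a ≤ v → v ≤ b → I (suc L₁) v ≡ true
    all-influenced v a≤v v≤b with v ≤? j | k ≤? v
    ... | yes v≤j | _ = influenced-left (suc L₁) v (proj₂ (proj₁ left-ok) v a≤v v≤j)
    ... | no _ | yes k≤v = influenced-right (suc L₁) v (proj₂ (proj₁ right-ok) v k≤v v≤b)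
    ... | no v≰j | no k≰v with interior-decomposition v v≰j (≰⇒> k≰v)
    ...   | i , refl , 1≤i , i≤m = interior-influenced i 1≤i i≤m

  glued-cost : cost a b glued ≡ cost a j pb + m′ + cost k b pd
  glued-cost = begin
    cost a b glued
      ≡⟨ cost-split₃ glued a≤j (s≤s (m≤m+n j m′)) k≤b ⟩
    cost a j glued + cost (suc j) (suc (j + m′)) glued + cost k b glued
      ≡⟨ cong₂ _+_ (cong₂ _+_ left interior) right ⟩
    cost a j pb + m′ + cost k b pd
      ∎
    where
    open ≡-Reasoning
    left : cost a j glued ≡ cost a j pb
    left = cost-cong a≤j λ v _ v≤j → glued-left v v≤j
    right : cost k b glued ≡ cost k b pd
    right = cost-cong k≤b λ v k≤v _ → glued-right v k≤v
    interior : cost (suc j) (suc (j + m′)) glued ≡ m′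
    interior = trans (cost-from (suc j) m′ glued)
      (trans (∑-cong m λ i i<m → trans (cong glued (sym (+-suc j i))) (glued-interior (suc i) (s≤s z≤n) i<m))
             (gadget-sum m′))

two-path-shape : ∀ j k → j + 1 ≤ k ∸ 1 → Σ ℕ λ m′ → k ≡ suc (suc (j + m′))
two-path-shape j zero j+1≤0 = contradiction (subst (_≤ 0) (+-comm j 1) j+1≤0) λ ()
two-path-shape j (suc k) j+1≤k = k ∸ suc j , cong suc (sym (m+[n∸m]≡n (subst (_≤ k) (+-comm j 1) j+1≤k)))

two-path-length : ∀ j m′ → suc (suc (j + m′)) ∸ j ≡ suc (suc m′)
two-path-length zero m′ = refl
two-path-length (suc j) m′ = two-path-length j m′

lemma3 : (n λ′ : ℕ) (t : ℕ → ℕ) → 2 ≤ λ′ → PathThresholds n t →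
    (j k : ℕ) → k < n → TwoPath t j k → ¬ (k ∸ j ∸ 1 ≡ 2) →
    Σ ℕ (λ a → Σ ℕ (λ b → Σ ℕ (λ d →
      IsOpt 0 (n ∸ 1) (TBI λ′ 0 (n ∸ 1) t) a ×
      IsOpt 0 j (TBI→ λ′ 1 0 j t) b ×
      IsOpt k (n ∸ 1) (TBI← λ′ 1 k (n ∸ 1) t) d ×
      (a ≡ b + (k ∸ j ∸ 2) + d))))
lemma3 n (suc L₁) t (s≤s 1≤L₁) _ j k k<n two-path m≢2 with two-path-shape j k (proj₁ two-path)
... | m′ , refl
  with optimum-exists (suc L₁) 0 j t L₁ j z≤n ≤-refl
     | optimum-exists (suc L₁) k (n ∸ 1) t L₁ k ≤-refl (∸-monoˡ-≤ 1 k<n)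
... | b , b-opt@((pb , pb-ok , pb-cost) , b-least) | d , d-opt@((pd , pd-ok , pd-cost) , d-least) =
  b + m′ + d , b , d ,
  ((glued , glued-TBI , trans glued-cost (cong₂ (λ x y → x + m′ + y) pb-cost pd-cost)) ,
   λ p solution → LowerBound.lower-bound (suc L₁) t p solution j m′ z≤n (∸-monoˡ-≤ 1 k<n) two-path b-least d-least) ,
  b-opt , d-opt , cong (λ x → b + x + d) (sym (cong (_∸ 2) (two-path-length j m′)))
  where
  open UpperBound t 1≤L₁ z≤n (∸-monoˡ-≤ 1 k<n) (m≢2 ∘ trans (cong (_∸ 1) (two-path-length j m′)))
    (proj₂ (proj₂ (proj₂ two-path))) pb-ok pd-ok
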